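{- Every rank-$t$ perturbation of a graph $G$ is a $t$-perturbation of $G$.
   Context: For a graph $G$, $A(G)$ is its adjacency matrix over $\mathrm{GF}(2)$. A graph $G_1$ is a rank-$t$ perturbation of a graph $G_2$ (on the same vertex set) if $A(G_1)$ can be obtained from $A(G_2)$ by adding (over $\mathrm{GF}(2)$) a matrix of rank at most $t$ and then changing all diagonal entries to $0$. Local complementation at $v$ replaces the induced subgraph on $N_G(v)$ by its complement; a vertex-minor of $G$ is an induced subgraph of a graph obtained from $G$ by local complementations. $G_1$ is a $t$-perturbation of $G_2$ if $V(G_1)=V(G_2)$ and some graph on $|V(G_1)|+t$ vertices contains both as vertex-minors. -}

module Defs where

open import Data.Nat using (ℕ; zero; suc; _+_)
open import Data.Fin using (Fin; zero; suc; _↑ˡ_; _≟_)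
open import Data.Bool using (Bool; true; false; _xor_; _∧_; if_then_else_)
open import Data.List using (List; foldl)
open import Data.Product using (Σ; ∃; _×_; _,_)
open import Relation.Nullary.Decidable using (⌊_⌋)
open import Relation.Binary.PropositionalEquality using (_≡_)

-- Square matrices over GF(2) = Bool (addition = xor, multiplication = ∧).
Mat : ℕ → Set
Mat n = Fin n → Fin n → Bool

record Graph (n : ℕ) : Set where
  field
    adj       : Mat n
    symmetric : ∀ x y → adj x y ≡ adj y x
    loopless  : ∀ x → adj x x ≡ false
open Graph public

⊕-sum : ∀ {t} → (Fin t → Bool) → Bool
⊕-sum {zero}  f = false
⊕-sum {suc t} f = f zero xor ⊕-sum (λ k → f (suc k))

-- rank M ≤ t over GF(2): the column space of M is spanned by t vectors
-- u₀,…,u_{t-1}, i.e. every column j of M equals Σ_k c k j · u_k.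
RankAtMost : ∀ {n} → ℕ → Mat n → Set
RankAtMost {n} t M =
  Σ (Fin t → Fin n → Bool) λ u →
  Σ (Fin t → Fin n → Bool) λ c →
    ∀ i j → M i j ≡ ⊕-sum (λ k → u k i ∧ c k j)

zeroDiag : ∀ {n} → Mat n → Mat n
zeroDiag M i j = if ⌊ i ≟ j ⌋ then false else M i j

_⊞_ : ∀ {n} → Mat n → Mat n → Mat n
(M ⊞ N) i j = M i j xor N i j

RankPerturbation : ∀ {n} → ℕ → Graph n → Graph n → Set
RankPerturbation {n} t G₁ G₂ =
  Σ (Mat n) λ M → RankAtMost t M × (∀ i j → adj G₁ i j ≡ zeroDiag (adj G₂ ⊞ M) i j)

localComp : ∀ {m} → Mat m → Fin m → Mat m
localComp A v x y = if ⌊ x ≟ y ⌋ then false else (A x y xor (A v x ∧ A v y))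

localComps : ∀ {m} → Mat m → List (Fin m) → Mat m
localComps = foldl localComp

-- G (on Fin n) is a vertex-minor of H (on Fin (n + t)), where the vertex
-- set of G is identified with the first n vertices of H: G is the induced
-- subgraph on these vertices of a graph obtained from H by local complementations.
VertexMinorOn : ∀ {n} t → Graph (n + t) → Graph n → Set
VertexMinorOn {n} t H G =
  Σ (List (Fin (n + t))) λ vs →
    ∀ x y → adj G x y ≡ localComps (adj H) vs (x ↑ˡ t) (y ↑ˡ t)

Perturbation : ∀ {n} → ℕ → Graph n → Graph n → Set
Perturbation {n} t G₁ G₂ =
  Σ (Graph (n + t)) λ H → VertexMinorOn t H G₁ × VertexMinorOn t H G₂

-- The perturbation M is symmetric, and over GF(2) a symmetric matrix of rank at most t
-- is a sum of terms s sᵀ and a bᵀ + b aᵀ using at most t vectors in all: if some M i i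
-- is 1, then M = s sᵀ + M′ with s the i-th column and rank M′ < rank M; if the diagonal
-- vanishes but M i j = 1, then M = a bᵀ + b aᵀ + M′ with a, b the i-th and j-th columns
-- and rank M′ ≤ rank M − 2. A term s sᵀ is realised by a new vertex with neighbourhood s
-- and a local complementation at it; a term a bᵀ + b aᵀ by two adjacent new vertices
-- with neighbourhoods a and b and a pivot on their edge. Attaching all new vertices to
-- G₂ gives a graph on n + t vertices that induces G₂ on the old vertices, and induces
-- G₁ = G₂ + M (off the diagonal) there after these local complementations.
module Submission where

open import Defs
open import Data.Nat using (ℕ; zero; suc; _+_)
open import Data.Fin using (Fin; zero; suc; _↑ˡ_; _↑ʳ_; _≟_; splitAt; join; punchIn)
open import Data.Fin.Properties using (splitAt-join; ↑ʳ-injective; any?)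
open import Data.Bool using (Bool; true; false; not; _xor_; _∧_; if_then_else_)
open import Data.Bool.Properties
  using (xor-∧-commutativeRing; xor-assoc; xor-comm; xor-identityʳ; ∧-comm; ∧-assoc;
         ∧-identityʳ; ∧-conicalʳ; ∧-distribˡ-xor; ∧-distribʳ-xor; ¬-not)
  renaming (_≟_ to _≟ᵇ_)
open import Data.List using (List; []; _∷_; map; foldl; _++_)
open import Data.List.Properties using (map-++; map-∘; foldl-++)
open import Data.Product using (Σ; ∃; _×_; _,_; proj₁; proj₂)
import Data.Product as Product
open import Data.Sum using (_⊎_; inj₁; inj₂; map₂)
open import Data.Sum.Properties using (≡-dec; inj₂-injective)
open import Data.Vec.Functional using () renaming (_++_ to _++ᵛ_; _∷_ to _∷ᵛ_; [] to []ᵛ)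
open import Function using (_∘_; id)
open import Function.Definitions using (Injective)
open import Algebra.Bundles using (CommutativeRing)
open import Algebra.Properties.Semiring.Sum (CommutativeRing.semiring xor-∧-commutativeRing)
  using (sum; sum-remove; ∑-distrib-+; *-distribˡ-sum; *-distribʳ-sum; sum-cong-≗)
open import Relation.Binary.Definitions using (DecidableEquality)
open import Relation.Nullary using (yes; no)
open import Relation.Nullary.Decidable using (⌊_⌋; True; toWitness; isYes≗does; dec-true; dec-false)
open import Relation.Binary.PropositionalEquality

BoolFun : ℕ → Set
BoolFun zero    = Bool
BoolFun (suc k) = Bool → BoolFun k

Pointwise : ∀ k → BoolFun k → BoolFun k → Set
Pointwise zero    f g = f ≡ g
Pointwise (suc k) f g = ∀ x → Pointwise k (f x) (g x)

TruthTable : ∀ k → BoolFun k → BoolFun k → Set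
TruthTable zero    f g = True (f ≟ᵇ g)
TruthTable (suc k) f g = TruthTable k (f true) (g true) × TruthTable k (f false) (g false)

truth-table : ∀ k {f g : BoolFun k} → TruthTable k f g → Pointwise k f g
truth-table zero    agree             = toWitness agree
truth-table (suc k) (agree , _) true  = truth-table k agree
truth-table (suc k) (_ , agree) false = truth-table k agree

xor-∧-zeroʳ : ∀ x y → x xor (y ∧ false) ≡ x
xor-∧-zeroʳ = truth-table 2 _

xor-cancelˡ : ∀ x y → x xor (x xor y) ≡ y
xor-cancelˡ = truth-table 2 _

xor-swap-cancel : ∀ x y → x xor (y xor x) ≡ y
xor-swap-cancel = truth-table 2 _

xor-cancel-middle : ∀ x y z → (x xor y) xor (z xor y) ≡ x xor z
xor-cancel-middle = truth-table 3 _

split-identity : ∀ p y m m₀ → (p ∧ y) xor m ≡ ((p xor m₀) ∧ y) xor (m xor (m₀ ∧ y))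
split-identity = truth-table 4 _

absorb-identity : ∀ m y r r₀ → ((m ∧ y) xor r) xor (m ∧ (y xor r₀)) ≡ r xor (m ∧ r₀)
absorb-identity = truth-table 4 _

pivot-identity : ∀ k a b c d →
  ((k xor (a ∧ b)) xor ((c xor a) ∧ (d xor b))) xor (c ∧ d) ≡ (k xor (a ∧ d)) xor (c ∧ b)
pivot-identity = truth-table 5 _

Symmetric : ∀ {V : Set} → (V → V → Bool) → Set
Symmetric K = ∀ x y → K x y ≡ K y x

Loopless : ∀ {V : Set} → (V → V → Bool) → Set
Loopless K = ∀ x → K x x ≡ false

_⊗_ : ∀ {n} → (Fin n → Bool) → (Fin n → Bool) → Mat n
(a ⊗ b) x y = a x ∧ b y

_⊙_ : ∀ {n} → (Fin n → Bool) → (Fin n → Bool) → Mat n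
a ⊙ b = (a ⊗ b) ⊞ (b ⊗ a)

column : ∀ {n} → Mat n → Fin n → Fin n → Bool
column M j i = M i j

⊞-symmetric : ∀ {n} {M N : Mat n} → Symmetric M → Symmetric N → Symmetric (M ⊞ N)
⊞-symmetric M-sym N-sym x y = cong₂ _xor_ (M-sym x y) (N-sym x y)

⊗-symmetric : ∀ {n} (s : Fin n → Bool) → Symmetric (s ⊗ s)
⊗-symmetric s x y = ∧-comm (s x) (s y)

⊙-symmetric : ∀ {n} (a b : Fin n → Bool) → Symmetric (a ⊙ b)
⊙-symmetric a b x y =
  trans (cong₂ _xor_ (∧-comm (a x) (b y)) (∧-comm (b x) (a y))) (xor-comm (b y ∧ a x) (a y ∧ b x))

module _ {V : Set} (_≟ᵛ_ : DecidableEquality V) where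

  ⌊≟⌋-refl : ∀ x → ⌊ x ≟ᵛ x ⌋ ≡ true
  ⌊≟⌋-refl x = trans (isYes≗does (x ≟ᵛ x)) (dec-true (x ≟ᵛ x) refl)

  ⌊≟⌋-≢ : ∀ {x y} → x ≢ y → ⌊ x ≟ᵛ y ⌋ ≡ false
  ⌊≟⌋-≢ {x} {y} x≢y = trans (isYes≗does (x ≟ᵛ y)) (dec-false (x ≟ᵛ y) x≢y)

  ⌊≟⌋-sym : ∀ x y → ⌊ x ≟ᵛ y ⌋ ≡ ⌊ y ≟ᵛ x ⌋
  ⌊≟⌋-sym x y with x ≟ᵛ y
  ... | yes refl = sym (⌊≟⌋-refl x)
  ... | no x≢y   = sym (⌊≟⌋-≢ (x≢y ∘ sym))

  ≡-from-off-diagonal : ∀ {K L : V → V → Bool} → Loopless K → Loopless L →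
    (∀ {x y} → x ≢ y → K x y ≡ L x y) → ∀ x y → K x y ≡ L x y
  ≡-from-off-diagonal K-loopless L-loopless K≡L x y with x ≟ᵛ y
  ... | yes refl = trans (K-loopless x) (sym (L-loopless x))
  ... | no x≢y   = K≡L x≢y

zeroDiag-≢ : ∀ {n} (M : Mat n) {x y} → x ≢ y → zeroDiag M x y ≡ M x y
zeroDiag-≢ M {x} {y} x≢y = cong (if_then false else M x y) (⌊≟⌋-≢ _≟_ x≢y)

zeroDiag-loopless : ∀ {n} (M : Mat n) → Loopless (zeroDiag M)
zeroDiag-loopless M x = cong (if_then false else M x x) (⌊≟⌋-refl _≟_ x)

zeroDiag-⊞-cancel : ∀ {n} (A M P : Mat n) x y →
  zeroDiag (zeroDiag (A ⊞ P) ⊞ (M ⊞ P)) x y ≡ zeroDiag (A ⊞ M) x y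
zeroDiag-⊞-cancel A M P =
  ≡-from-off-diagonal _≟_ (zeroDiag-loopless (zeroDiag (A ⊞ P) ⊞ (M ⊞ P))) (zeroDiag-loopless (A ⊞ M))
                      P-cancels
  where
  open ≡-Reasoning
  P-cancels : ∀ {x y} → x ≢ y → zeroDiag (zeroDiag (A ⊞ P) ⊞ (M ⊞ P)) x y ≡ zeroDiag (A ⊞ M) x y
  P-cancels {x} {y} x≢y = begin
    zeroDiag (zeroDiag (A ⊞ P) ⊞ (M ⊞ P)) x y   ≡⟨ zeroDiag-≢ (zeroDiag (A ⊞ P) ⊞ (M ⊞ P)) x≢y ⟩
    zeroDiag (A ⊞ P) x y xor (M x y xor P x y)  ≡⟨ cong (_xor (M x y xor P x y)) (zeroDiag-≢ (A ⊞ P) x≢y) ⟩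
    (A x y xor P x y) xor (M x y xor P x y)     ≡⟨ xor-cancel-middle (A x y) (P x y) (M x y) ⟩
    A x y xor M x y                             ≡⟨ zeroDiag-≢ (A ⊞ M) x≢y ⟨
    zeroDiag (A ⊞ M) x y                        ∎

-- Rank one elimination

⊕-sum≡sum : ∀ {t} (f : Fin t → Bool) → ⊕-sum f ≡ sum f
⊕-sum≡sum {zero}  f = refl
⊕-sum≡sum {suc t} f = cong (f zero xor_) (⊕-sum≡sum (f ∘ suc))

⊕-sum-true : ∀ {t} (f : Fin t → Bool) → ⊕-sum f ≡ true → ∃ λ k → f k ≡ true
⊕-sum-true {zero}  f ()
⊕-sum-true {suc t} f sum≡true with f zero in f₀
... | true  = zero , f₀
... | false = Product.map suc id (⊕-sum-true (f ∘ suc) sum≡true)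

_·_ : ∀ {t} → (Fin t → Bool) → (Fin t → Bool) → Bool
u · c = sum (λ k → u k ∧ c k)

·-xor-∧ʳ : ∀ {t} (u c d : Fin t → Bool) y →
  u · (λ k → c k xor (d k ∧ y)) ≡ (u · c) xor ((u · d) ∧ y)
·-xor-∧ʳ u c d y = begin
  u · (λ k → c k xor (d k ∧ y))
    ≡⟨ sum-cong-≗ distribute ⟩
  sum (λ k → (u k ∧ c k) xor ((u k ∧ d k) ∧ y))
    ≡⟨ ∑-distrib-+ (λ k → u k ∧ c k) (λ k → (u k ∧ d k) ∧ y) ⟩
  (u · c) xor sum (λ k → (u k ∧ d k) ∧ y)
    ≡⟨ cong ((u · c) xor_) (*-distribʳ-sum y (λ k → u k ∧ d k)) ⟨
  (u · c) xor ((u · d) ∧ y)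
    ∎
  where
  open ≡-Reasoning
  distribute : ∀ k → u k ∧ (c k xor (d k ∧ y)) ≡ (u k ∧ c k) xor ((u k ∧ d k) ∧ y)
  distribute k = trans (∧-distribˡ-xor (u k) (c k) (d k ∧ y))
                       (cong ((u k ∧ c k) xor_) (sym (∧-assoc (u k) (d k) y)))

·-xor-∧ˡ : ∀ {t} (u w c : Fin t → Bool) m →
  (λ k → u k xor (m ∧ w k)) · c ≡ (u · c) xor (m ∧ (w · c))
·-xor-∧ˡ u w c m = begin
  (λ k → u k xor (m ∧ w k)) · c
    ≡⟨ sum-cong-≗ distribute ⟩
  sum (λ k → (u k ∧ c k) xor (m ∧ (w k ∧ c k)))
    ≡⟨ ∑-distrib-+ (λ k → u k ∧ c k) (λ k → m ∧ (w k ∧ c k)) ⟩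
  (u · c) xor sum (λ k → m ∧ (w k ∧ c k))
    ≡⟨ cong ((u · c) xor_) (*-distribˡ-sum m (λ k → w k ∧ c k)) ⟨
  (u · c) xor (m ∧ (w · c))
    ∎
  where
  open ≡-Reasoning
  distribute : ∀ k → (u k xor (m ∧ w k)) ∧ c k ≡ (u k ∧ c k) xor (m ∧ (w k ∧ c k))
  distribute k = trans (∧-distribʳ-xor (c k) (u k) (m ∧ w k))
                       (cong ((u k ∧ c k) xor_) (∧-assoc m (w k) (c k)))

RankAtMost-cong : ∀ {n t} {M N : Mat n} → (∀ i j → M i j ≡ N i j) → RankAtMost t M → RankAtMost t N
RankAtMost-cong M≡N (u , c , M≡uc) = u , c , λ i j → trans (sym (M≡N i j)) (M≡uc i j)

-- The other t terms are reduced modulo the pivot term y so that they vanish at column j₀.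
RankAtMost-split : ∀ {n t} {M : Mat n} {i₀ j₀} → RankAtMost (suc t) M → M i₀ j₀ ≡ true →
  Σ (Fin n → Bool) λ y → Σ (Mat n) λ R →
    RankAtMost t R × (∀ i j → M i j ≡ (column M j₀ ⊗ y) i j xor R i j)
RankAtMost-split {n} {t} {M} {i₀} {j₀} (u , c , M≡uc) Mi₀j₀ =
  y , R , (u′ , c′ , λ _ _ → refl) , M≡yR
  where
  pivot-term : ∃ λ k₀ → u k₀ i₀ ∧ c k₀ j₀ ≡ true
  pivot-term = ⊕-sum-true _ (trans (sym (M≡uc i₀ j₀)) Mi₀j₀)
  k₀ : Fin (suc t)
  k₀ = proj₁ pivot-term
  y : Fin n → Bool
  y = c k₀
  y-j₀ : y j₀ ≡ true
  y-j₀ = ∧-conicalʳ _ _ (proj₂ pivot-term)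
  u′ c″ c′ : Fin t → Fin n → Bool
  u′ k = u (punchIn k₀ k)
  c″ k = c (punchIn k₀ k)
  c′ k j = c″ k j xor (c″ k j₀ ∧ y j)
  R N : Mat n
  R i j = ⊕-sum (λ k → u′ k i ∧ c′ k j)
  N i j = (λ k → u′ k i) · (λ k → c″ k j)
  M≡N : ∀ i j → M i j ≡ (u k₀ i ∧ y j) xor N i j
  M≡N i j = trans (M≡uc i j) (trans (⊕-sum≡sum (λ k → u k i ∧ c k j))
                                    (sum-remove {i = k₀} (λ k → u k i ∧ c k j)))
  R≡N : ∀ i j → R i j ≡ N i j xor (N i j₀ ∧ y j)
  R≡N i j = trans (⊕-sum≡sum (λ k → u′ k i ∧ c′ k j))
                  (·-xor-∧ʳ (λ k → u′ k i) (λ k → c″ k j) (λ k → c″ k j₀) (y j))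
  M-column-j₀ : ∀ i → u k₀ i xor N i j₀ ≡ M i j₀
  M-column-j₀ i = sym (trans (M≡N i j₀) (trans (cong (λ p → (u k₀ i ∧ p) xor N i j₀) y-j₀)
                                               (cong (_xor N i j₀) (∧-identityʳ (u k₀ i)))))
  M≡yR : ∀ i j → M i j ≡ (M i j₀ ∧ y j) xor R i j
  M≡yR i j = begin
    M i j
      ≡⟨ M≡N i j ⟩
    (u k₀ i ∧ y j) xor N i j
      ≡⟨ split-identity (u k₀ i) (y j) (N i j) (N i j₀) ⟩
    ((u k₀ i xor N i j₀) ∧ y j) xor (N i j xor (N i j₀ ∧ y j))
      ≡⟨ cong₂ (λ p q → (p ∧ y j) xor q) (M-column-j₀ i) (sym (R≡N i j)) ⟩
    (M i j₀ ∧ y j) xor R i j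
      ∎
    where open ≡-Reasoning

RankAtMost-absorb : ∀ {n t} {M R : Mat n} {m y : Fin n → Bool} {i₀} → RankAtMost t R →
  (∀ i j → M i j ≡ (m ⊗ y) i j xor R i j) → m i₀ ≡ true → RankAtMost t (M ⊞ (m ⊗ M i₀))
RankAtMost-absorb {n} {t} {M} {R} {m} {y} {i₀} (u , c , R≡uc) M≡myR mi₀ = u′ , c , M′≡u′c
  where
  u′ : Fin t → Fin n → Bool
  u′ k i = u k i xor (m i ∧ u k i₀)
  R≡u·c : ∀ i j → R i j ≡ (λ k → u k i) · (λ k → c k j)
  R≡u·c i j = trans (R≡uc i j) (⊕-sum≡sum (λ k → u k i ∧ c k j))
  Mi₀≡yR : ∀ j → M i₀ j ≡ y j xor R i₀ j
  Mi₀≡yR j = trans (M≡myR i₀ j) (cong (λ p → (p ∧ y j) xor R i₀ j) mi₀)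
  M′≡u′c : ∀ i j → M i j xor (m i ∧ M i₀ j) ≡ ⊕-sum (λ k → u′ k i ∧ c k j)
  M′≡u′c i j = begin
    M i j xor (m i ∧ M i₀ j)
      ≡⟨ cong₂ (λ p q → p xor (m i ∧ q)) (M≡myR i j) (Mi₀≡yR j) ⟩
    ((m i ∧ y j) xor R i j) xor (m i ∧ (y j xor R i₀ j))
      ≡⟨ absorb-identity (m i) (y j) (R i j) (R i₀ j) ⟩
    R i j xor (m i ∧ R i₀ j)
      ≡⟨ cong₂ (λ p q → p xor (m i ∧ q)) (R≡u·c i j) (R≡u·c i₀ j) ⟩
    ((λ k → u k i) · (λ k → c k j)) xor (m i ∧ ((λ k → u k i₀) · (λ k → c k j)))
      ≡⟨ ·-xor-∧ˡ (λ k → u k i) (λ k → u k i₀) (λ k → c k j) (m i) ⟨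
    (λ k → u′ k i) · (λ k → c k j)
      ≡⟨ ⊕-sum≡sum (λ k → u′ k i ∧ c k j) ⟨
    ⊕-sum (λ k → u′ k i ∧ c k j)
      ∎
    where open ≡-Reasoning

RankAtMost-eliminate : ∀ {n t} {M : Mat n} {i₀ j₀} → RankAtMost (suc t) M → M i₀ j₀ ≡ true →
  RankAtMost t (M ⊞ (column M j₀ ⊗ M i₀))
RankAtMost-eliminate rk Mi₀j₀ with RankAtMost-split rk Mi₀j₀
... | _ , _ , rk-R , M≡yR = RankAtMost-absorb rk-R M≡yR Mi₀j₀

symmetric-elimination≡ : ∀ {n} {M : Mat n} {i} → Symmetric M → ∀ x y →
  (M ⊞ (column M i ⊗ M i)) x y ≡ (M ⊞ (column M i ⊗ column M i)) x y
symmetric-elimination≡ {M = M} {i} M-sym x y = cong (λ p → M x y xor (M x i ∧ p)) (M-sym i y)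

alternating-elimination-transpose : ∀ {n} {M : Mat n} {i j} → Symmetric M → Loopless M →
  M i j ≡ true → (M ⊞ (column M j ⊗ M i)) j i ≡ true
alternating-elimination-transpose {M = M} {i} {j} M-sym M-loopless Mij =
  cong₂ (λ p q → p xor (q ∧ M i i)) (trans (M-sym j i) Mij) (M-loopless j)

alternating-elimination≡ : ∀ {n} {M : Mat n} {i j} → Symmetric M → Loopless M → ∀ x y →
  let M₁ = M ⊞ (column M j ⊗ M i) in
  (M₁ ⊞ (column M₁ i ⊗ M₁ j)) x y ≡ (M ⊞ (column M i ⊙ column M j)) x y
alternating-elimination≡ {M = M} {i} {j} M-sym M-loopless x y = begin
  (M x y xor (M x j ∧ M i y)) xor ((M x i xor (M x j ∧ M i i)) ∧ (M j y xor (M j j ∧ M i y)))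
    ≡⟨ cong₂ (λ p q → (M x y xor (M x j ∧ M i y))
                        xor ((M x i xor (M x j ∧ p)) ∧ (M j y xor (q ∧ M i y))))
             (M-loopless i) (M-loopless j) ⟩
  (M x y xor (M x j ∧ M i y)) xor ((M x i xor (M x j ∧ false)) ∧ (M j y xor false))
    ≡⟨ cong₂ (λ p q → (M x y xor (M x j ∧ M i y)) xor (p ∧ q))
             (xor-∧-zeroʳ (M x i) (M x j)) (xor-identityʳ (M j y)) ⟩
  (M x y xor (M x j ∧ M i y)) xor (M x i ∧ M j y)
    ≡⟨ cong₂ (λ p q → (M x y xor (M x j ∧ p)) xor (M x i ∧ q)) (M-sym i y) (M-sym j y) ⟩
  (M x y xor (M x j ∧ M y i)) xor (M x i ∧ M y j)
    ≡⟨ xor-assoc (M x y) (M x j ∧ M y i) (M x i ∧ M y j) ⟩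
  M x y xor ((M x j ∧ M y i) xor (M x i ∧ M y j))
    ≡⟨ cong (M x y xor_) (xor-comm (M x j ∧ M y i) (M x i ∧ M y j)) ⟩
  M x y xor ((M x i ∧ M y j) xor (M x j ∧ M y i))
    ∎
  where open ≡-Reasoning

-- For V = Fin m and Fin._≟_ these are definitionally localComp and localComps.
module _ {V : Set} (_≟ᵛ_ : DecidableEquality V) where

  localComp′ : (V → V → Bool) → V → V → V → Bool
  localComp′ K v x y = if ⌊ x ≟ᵛ y ⌋ then false else (K x y xor (K v x ∧ K v y))

  localComps′ : (V → V → Bool) → List V → V → V → Bool
  localComps′ = foldl localComp′

  localComp′-loopless : ∀ K v → Loopless (localComp′ K v)
  localComp′-loopless K v x = cong (if_then false else _) (⌊≟⌋-refl _≟ᵛ_ x)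

  localComp′-≢ : ∀ K v {x y} → x ≢ y → localComp′ K v x y ≡ K x y xor (K v x ∧ K v y)
  localComp′-≢ K v x≢y = cong (if_then false else _) (⌊≟⌋-≢ _≟ᵛ_ x≢y)

  pivot : ∀ {K v w x y} → K v v ≡ false → K v w ≡ true → K w v ≡ true → w ≢ v →
    x ≢ v → x ≢ w → y ≢ v → y ≢ w → x ≢ y →
    localComps′ K (v ∷ w ∷ v ∷ []) x y ≡ (K x y xor (K v x ∧ K w y)) xor (K w x ∧ K v y)
  pivot {K} {v} {w} {x} {y} Kvv Kvw Kwv w≢v x≢v x≢w y≢v y≢w x≢y = begin
    localComp′ K₂ v x y
      ≡⟨ localComp′-≢ K₂ v x≢y ⟩
    K₂ x y xor (K₂ v x ∧ K₂ v y)
      ≡⟨ cong₂ _xor_ (localComp′-≢ K₁ w x≢y)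
                     (cong₂ _∧_ (K₂-v x≢v x≢w) (K₂-v y≢v y≢w)) ⟩
    (K₁ x y xor (K₁ w x ∧ K₁ w y)) xor (K w x ∧ K w y)
      ≡⟨ cong (_xor (K w x ∧ K w y))
              (cong₂ _xor_ (localComp′-≢ K v x≢y) (cong₂ _∧_ (K₁-w x≢w) (K₁-w y≢w))) ⟩
    ((K x y xor (K v x ∧ K v y)) xor ((K w x xor K v x) ∧ (K w y xor K v y))) xor (K w x ∧ K w y)
      ≡⟨ pivot-identity (K x y) (K v x) (K v y) (K w x) (K w y) ⟩
    (K x y xor (K v x ∧ K w y)) xor (K w x ∧ K v y)
      ∎
    where
    open ≡-Reasoning
    K₁ K₂ : V → V → Bool
    K₁ = localComp′ K v
    K₂ = localComp′ K₁ w
    K₁-v : ∀ {z} → z ≢ v → K₁ v z ≡ K v z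
    K₁-v {z} z≢v = trans (localComp′-≢ K v (z≢v ∘ sym))
                         (trans (cong (λ p → K v z xor (p ∧ K v z)) Kvv) (xor-identityʳ (K v z)))
    K₁-w : ∀ {z} → z ≢ w → K₁ w z ≡ K w z xor K v z
    K₁-w {z} z≢w = trans (localComp′-≢ K v (z≢w ∘ sym)) (cong (λ p → K w z xor (p ∧ K v z)) Kvw)
    K₁-wv : K₁ w v ≡ true
    K₁-wv = trans (localComp′-≢ K v w≢v) (cong₂ _xor_ Kwv (cong₂ _∧_ Kvw Kvv))
    K₂-v : ∀ {z} → z ≢ v → z ≢ w → K₂ v z ≡ K w z
    K₂-v {z} z≢v z≢w = begin
      K₂ v z                       ≡⟨ localComp′-≢ K₁ w (z≢v ∘ sym) ⟩
      K₁ v z xor (K₁ w v ∧ K₁ w z) ≡⟨ cong₂ _xor_ (K₁-v z≢v) (cong₂ _∧_ K₁-wv (K₁-w z≢w)) ⟩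
      K v z xor (K w z xor K v z)  ≡⟨ xor-swap-cancel (K v z) (K w z) ⟩
      K w z                        ∎

localComps′-induced : ∀ {V W : Set} (_≟ᵛ_ : DecidableEquality V) (_≟ʷ_ : DecidableEquality W)
  {e : V → W} → Injective _≡_ _≡_ e → ∀ {K : W → W → Bool} {L : V → V → Bool} →
  (∀ a b → K (e a) (e b) ≡ L a b) →
  ∀ vs a b → localComps′ _≟ʷ_ K (map e vs) (e a) (e b) ≡ localComps′ _≟ᵛ_ L vs a b
localComps′-induced _≟ᵛ_ _≟ʷ_ e-injective K≡L [] a b = K≡L a b
localComps′-induced _≟ᵛ_ _≟ʷ_ {e} e-injective {K} {L} K≡L (v ∷ vs) =
  localComps′-induced _≟ᵛ_ _≟ʷ_ e-injective K′≡L′ vs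
  where
  ⌊≟⌋-e : ∀ a b → ⌊ e a ≟ʷ e b ⌋ ≡ ⌊ a ≟ᵛ b ⌋
  ⌊≟⌋-e a b with a ≟ᵛ b
  ... | yes refl = ⌊≟⌋-refl _≟ʷ_ (e a)
  ... | no a≢b   = ⌊≟⌋-≢ _≟ʷ_ (a≢b ∘ e-injective)
  K′≡L′ : ∀ a b → localComp′ _≟ʷ_ K (e v) (e a) (e b) ≡ localComp′ _≟ᵛ_ L v a b
  K′≡L′ a b = cong₂ (if_then false else_) (⌊≟⌋-e a b)
                    (cong₂ _xor_ (K≡L a b) (cong₂ _∧_ (K≡L v a) (K≡L v b)))

-- Gadgets

attach : ∀ {n t} → Mat n → (Fin t → Fin n → Bool) → Mat t → Fin n ⊎ Fin t → Fin n ⊎ Fin t → Bool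
attach A X B (inj₁ x) (inj₁ y) = A x y
attach A X B (inj₁ x) (inj₂ z) = X z x
attach A X B (inj₂ z) (inj₁ x) = X z x
attach A X B (inj₂ z) (inj₂ w) = B z w

attach-symmetric : ∀ {n t} {A : Mat n} {X : Fin t → Fin n → Bool} {B : Mat t} →
  Symmetric A → Symmetric B → Symmetric (attach A X B)
attach-symmetric A-sym B-sym (inj₁ x) (inj₁ y) = A-sym x y
attach-symmetric A-sym B-sym (inj₁ x) (inj₂ z) = refl
attach-symmetric A-sym B-sym (inj₂ z) (inj₁ x) = refl
attach-symmetric A-sym B-sym (inj₂ z) (inj₂ w) = B-sym z w

attach-loopless : ∀ {n t} {A : Mat n} {X : Fin t → Fin n → Bool} {B : Mat t} →
  Loopless A → Loopless B → Loopless (attach A X B)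
attach-loopless A-loopless B-loopless (inj₁ x) = A-loopless x
attach-loopless A-loopless B-loopless (inj₂ z) = B-loopless z

attachGraph : ∀ {n t} → Graph n → (Fin t → Fin n → Bool) → Graph t → Graph (n + t)
attachGraph {n} G X B = record
  { adj       = λ i j → attach (adj G) X (adj B) (splitAt n i) (splitAt n j)
  ; symmetric = λ i j → attach-symmetric (symmetric G) (symmetric B) (splitAt n i) (splitAt n j)
  ; loopless  = λ i → attach-loopless (loopless G) (loopless B) (splitAt n i)
  }

_⊎ᴳ_ : ∀ {k t} → Graph k → Graph t → Graph (k + t)
G ⊎ᴳ B = attachGraph G (λ _ _ → false) B

edgeless : ∀ t → Graph t
edgeless t = record { adj = λ _ _ → false ; symmetric = λ _ _ → refl ; loopless = λ _ → refl }

complete : ∀ k → Graph k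
complete k = record
  { adj       = λ i j → not ⌊ i ≟ j ⌋
  ; symmetric = λ i j → cong not (⌊≟⌋-sym _≟_ i j)
  ; loopless  = λ i → cong not (⌊≟⌋-refl _≟_ i)
  }

_≟⊎_ : ∀ {n t} → DecidableEquality (Fin n ⊎ Fin t)
_≟⊎_ = ≡-dec _≟_ _≟_

shift : ∀ {n} k {t} → Fin n ⊎ Fin t → Fin n ⊎ Fin (k + t)
shift k = map₂ (k ↑ʳ_)

shift-injective : ∀ {n} k {t} → Injective _≡_ _≡_ (shift {n} k {t})
shift-injective k {x = inj₁ x} {inj₁ .x} refl = refl
shift-injective k {x = inj₂ a} {inj₂ b} eq   = cong inj₂ (↑ʳ-injective k a b (inj₂-injective eq))

join-injective : ∀ m n → Injective _≡_ _≡_ (join m n)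
join-injective m n {a} {b} eq =
  trans (sym (splitAt-join m n a)) (trans (cong (splitAt m) eq) (splitAt-join m n b))

-- Quantifying over the old graph A is what lets gadgets be stacked (see _∷ᴳ_).
record Gadget (n t : ℕ) (M : Mat n) : Set where
  field
    neighbours : Fin t → Fin n → Bool
    inner      : Graph t
    moves      : List (Fin t)
    realises   : ∀ (A : Mat n) → Loopless A → ∀ x y →
      localComps′ _≟⊎_ (attach A neighbours (adj inner)) (map inj₂ moves) (inj₁ x) (inj₁ y)
        ≡ zeroDiag (A ⊞ M) x y

-- k new vertices forming a clique, whose moves add P to the old part and leave
-- every edge at the remaining new vertices unchanged.
record Elementary (n k : ℕ) (P : Mat n) : Set where
  field
    neighbours : Fin k → Fin n → Bool
    moves      : List (Fin k)
    effect     : ∀ {t} (A : Mat n) (X : Fin t → Fin n → Bool) (B : Graph t) → ∀ p q →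
      localComps′ _≟⊎_ (attach A (neighbours ++ᵛ X) (adj (complete k ⊎ᴳ B)))
                       (map inj₂ (map (_↑ˡ t) moves)) (shift k p) (shift k q)
        ≡ attach (zeroDiag (A ⊞ P)) X (adj B) p q

gadget-zero : ∀ {n t} {M : Mat n} → (∀ i j → M i j ≡ false) → Gadget n t M
gadget-zero {n} {t} {M} M≡0 = record
  { neighbours = λ _ _ → false ; inner = edgeless t ; moves = [] ; realises = realises }
  where
  realises : ∀ (A : Mat n) → Loopless A → ∀ x y → A x y ≡ zeroDiag (A ⊞ M) x y
  realises A A-loopless = ≡-from-off-diagonal _≟_ A-loopless (zeroDiag-loopless (A ⊞ M)) λ {x} {y} x≢y →
    sym (trans (zeroDiag-≢ (A ⊞ M) x≢y)
               (trans (cong (A x y xor_) (M≡0 x y)) (xor-identityʳ (A x y))))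

infixr 5 _∷ᴳ_
_∷ᴳ_ : ∀ {n k t} {M P : Mat n} → Elementary n k P → Gadget n t (M ⊞ P) → Gadget n (k + t) M
_∷ᴳ_ {n} {k} {t} {M} {P} E G = record
  { neighbours = E.neighbours ++ᵛ G.neighbours
  ; inner      = complete k ⊎ᴳ G.inner
  ; moves      = map (_↑ˡ t) E.moves ++ map (k ↑ʳ_) G.moves
  ; realises   = realises
  }
  where
  module E = Elementary E
  module G = Gadget G
  first-moves : List (Fin n ⊎ Fin (k + t))
  first-moves = map inj₂ (map (_↑ˡ t) E.moves)
  moves-split : map inj₂ (map (_↑ˡ t) E.moves ++ map (k ↑ʳ_) G.moves)
              ≡ first-moves ++ map (shift k) (map inj₂ G.moves)
  moves-split = trans (map-++ inj₂ (map (_↑ˡ t) E.moves) (map (k ↑ʳ_) G.moves))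
                      (cong (first-moves ++_) (trans (sym (map-∘ G.moves)) (map-∘ G.moves)))
  realises : ∀ (A : Mat n) → Loopless A → ∀ x y →
    localComps′ _≟⊎_ (attach A (E.neighbours ++ᵛ G.neighbours) (adj (complete k ⊎ᴳ G.inner)))
      (map inj₂ (map (_↑ˡ t) E.moves ++ map (k ↑ʳ_) G.moves)) (inj₁ x) (inj₁ y)
      ≡ zeroDiag (A ⊞ M) x y
  realises A A-loopless x y = begin
    localComps′ _≟⊎_ K (map inj₂ (map (_↑ˡ t) E.moves ++ map (k ↑ʳ_) G.moves)) (inj₁ x) (inj₁ y)
      ≡⟨ cong (λ ms → localComps′ _≟⊎_ K ms (inj₁ x) (inj₁ y)) moves-split ⟩
    localComps′ _≟⊎_ K (first-moves ++ map (shift k) (map inj₂ G.moves)) (inj₁ x) (inj₁ y)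
      ≡⟨ cong (λ L → L (inj₁ x) (inj₁ y)) (foldl-++ (localComp′ _≟⊎_) K first-moves _) ⟩
    localComps′ _≟⊎_ (localComps′ _≟⊎_ K first-moves) (map (shift k) (map inj₂ G.moves))
      (shift k (inj₁ x)) (shift k (inj₁ y))
      ≡⟨ localComps′-induced _≟⊎_ _≟⊎_ (shift-injective k) (E.effect A G.neighbours G.inner)
                             (map inj₂ G.moves) (inj₁ x) (inj₁ y) ⟩
    localComps′ _≟⊎_ (attach (zeroDiag (A ⊞ P)) G.neighbours (adj G.inner)) (map inj₂ G.moves)
      (inj₁ x) (inj₁ y)
      ≡⟨ G.realises (zeroDiag (A ⊞ P)) (zeroDiag-loopless (A ⊞ P)) x y ⟩
    zeroDiag (zeroDiag (A ⊞ P) ⊞ (M ⊞ P)) x y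
      ≡⟨ zeroDiag-⊞-cancel A M P x y ⟩
    zeroDiag (A ⊞ M) x y
      ∎
    where
    open ≡-Reasoning
    K : Fin n ⊎ Fin (k + t) → Fin n ⊎ Fin (k + t) → Bool
    K = attach A (E.neighbours ++ᵛ G.neighbours) (adj (complete k ⊎ᴳ G.inner))

square : ∀ {n} (s : Fin n → Bool) → Elementary n 1 (s ⊗ s)
square {n} s = record { neighbours = λ _ → s ; moves = zero ∷ [] ; effect = effect }
  where
  effect : ∀ {t} (A : Mat n) (X : Fin t → Fin n → Bool) (B : Graph t) → ∀ p q →
    localComp′ _≟⊎_ (attach A ((λ _ → s) ++ᵛ X) (adj (complete 1 ⊎ᴳ B)))
                    (inj₂ zero) (shift 1 p) (shift 1 q)
      ≡ attach (zeroDiag (A ⊞ (s ⊗ s))) X (adj B) p q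
  effect {t} A X B =
    ≡-from-off-diagonal _≟⊎_ (λ p → localComp′-loopless _≟⊎_ K v (shift 1 p))
      (attach-loopless (zeroDiag-loopless (A ⊞ (s ⊗ s))) (loopless B))
      λ {p} {q} p≢q → trans (localComp′-≢ _≟⊎_ K v (p≢q ∘ shift-injective 1)) (entry p q p≢q)
    where
    K : Fin n ⊎ Fin (1 + t) → Fin n ⊎ Fin (1 + t) → Bool
    K = attach A ((λ _ → s) ++ᵛ X) (adj (complete 1 ⊎ᴳ B))
    v : Fin n ⊎ Fin (1 + t)
    v = inj₂ zero
    entry : ∀ p q → p ≢ q → K (shift 1 p) (shift 1 q) xor (K v (shift 1 p) ∧ K v (shift 1 q))
                            ≡ attach (zeroDiag (A ⊞ (s ⊗ s))) X (adj B) p q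
    entry (inj₁ x) (inj₁ y) p≢q = sym (zeroDiag-≢ (A ⊞ (s ⊗ s)) (p≢q ∘ cong inj₁))
    entry (inj₁ x) (inj₂ z) _   = xor-∧-zeroʳ (X z x) (s x)
    entry (inj₂ z) (inj₁ x) _   = xor-identityʳ (X z x)
    entry (inj₂ z) (inj₂ w) _   = xor-identityʳ (adj B z w)

pivot-on : ∀ {n} (a b : Fin n → Bool) → Elementary n 2 (a ⊙ b)
pivot-on {n} a b = record
  { neighbours = a ∷ᵛ b ∷ᵛ []ᵛ ; moves = zero ∷ suc zero ∷ zero ∷ [] ; effect = effect }
  where
  effect : ∀ {t} (A : Mat n) (X : Fin t → Fin n → Bool) (B : Graph t) → ∀ p q →
    localComps′ _≟⊎_ (attach A ((a ∷ᵛ b ∷ᵛ []ᵛ) ++ᵛ X) (adj (complete 2 ⊎ᴳ B)))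
      (inj₂ zero ∷ inj₂ (suc zero) ∷ inj₂ zero ∷ []) (shift 2 p) (shift 2 q)
      ≡ attach (zeroDiag (A ⊞ (a ⊙ b))) X (adj B) p q
  effect {t} A X B =
    ≡-from-off-diagonal _≟⊎_ (λ p → localComp′-loopless _≟⊎_ K₂ v (shift 2 p))
      (attach-loopless (zeroDiag-loopless (A ⊞ (a ⊙ b))) (loopless B))
      λ {p} {q} p≢q →
        trans (pivot _≟⊎_ {K} refl refl refl (λ ()) (≢v p) (≢w p) (≢v q) (≢w q)
                     (p≢q ∘ shift-injective 2))
              (entry p q p≢q)
    where
    v w : Fin n ⊎ Fin (2 + t)
    v = inj₂ zero
    w = inj₂ (suc zero)
    K K₂ : Fin n ⊎ Fin (2 + t) → Fin n ⊎ Fin (2 + t) → Bool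
    K  = attach A ((a ∷ᵛ b ∷ᵛ []ᵛ) ++ᵛ X) (adj (complete 2 ⊎ᴳ B))
    K₂ = localComp′ _≟⊎_ (localComp′ _≟⊎_ K v) w
    ≢v : ∀ p → shift 2 p ≢ v
    ≢v (inj₁ _) ()
    ≢v (inj₂ _) ()
    ≢w : ∀ p → shift 2 p ≢ w
    ≢w (inj₁ _) ()
    ≢w (inj₂ _) ()
    entry : ∀ p q → p ≢ q →
      (K (shift 2 p) (shift 2 q) xor (K v (shift 2 p) ∧ K w (shift 2 q)))
        xor (K w (shift 2 p) ∧ K v (shift 2 q))
        ≡ attach (zeroDiag (A ⊞ (a ⊙ b))) X (adj B) p q
    entry (inj₁ x) (inj₁ y) p≢q =
      trans (xor-assoc (A x y) (a x ∧ b y) (b x ∧ a y))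
            (sym (zeroDiag-≢ (A ⊞ (a ⊙ b)) (p≢q ∘ cong inj₁)))
    entry (inj₁ x) (inj₂ z) _ = trans (xor-∧-zeroʳ _ (b x)) (xor-∧-zeroʳ (X z x) (a x))
    entry (inj₂ z) (inj₁ x) _ = trans (xor-identityʳ _) (xor-identityʳ (X z x))
    entry (inj₂ z) (inj₂ u) _ = trans (xor-identityʳ _) (xor-identityʳ (adj B z u))

mutual
  gadget : ∀ {n} t {M : Mat n} → Symmetric M → RankAtMost t M → Gadget n t M
  gadget zero    _ (_ , _ , M≡0) = gadget-zero M≡0
  gadget (suc t) {M} M-sym rk with any? (λ i → M i i ≟ᵇ true)
  ... | yes (i , Mii) =
    square (column M i) ∷ᴳ
      gadget t (⊞-symmetric M-sym (⊗-symmetric (column M i)))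
               (RankAtMost-cong (symmetric-elimination≡ M-sym) (RankAtMost-eliminate rk Mii))
  ... | no no-diagonal with any? (λ i → any? (λ j → M i j ≟ᵇ true))
  ...   | no M≢1 = gadget-zero (λ i j → ¬-not (λ Mij → M≢1 (i , j , Mij)))
  ...   | yes (i , j , Mij) =
    gadget-alternating t M-sym (λ x → ¬-not (λ Mxx → no-diagonal (x , Mxx))) Mij
                       (RankAtMost-eliminate rk Mij)

  gadget-alternating : ∀ {n} t {M : Mat n} {i j} → Symmetric M → Loopless M → M i j ≡ true →
    RankAtMost t (M ⊞ (column M j ⊗ M i)) → Gadget n (suc t) M
  -- a nonzero alternating matrix has rank at least 2
  gadget-alternating zero {i = i} {j} M-sym M-loopless Mij (_ , _ , M₁≡0)
    with () ← trans (sym (alternating-elimination-transpose M-sym M-loopless Mij)) (M₁≡0 j i)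
  gadget-alternating (suc t) {M} {i} {j} M-sym M-loopless Mij rk₁ =
    pivot-on (column M i) (column M j) ∷ᴳ
      gadget t (⊞-symmetric M-sym (⊙-symmetric (column M i) (column M j)))
               (RankAtMost-cong (alternating-elimination≡ M-sym M-loopless)
                                (RankAtMost-eliminate rk₁ M₁-ji))
    where
    M₁-ji : (M ⊞ (column M j ⊗ M i)) j i ≡ true
    M₁-ji = alternating-elimination-transpose M-sym M-loopless Mij

rankPerturbation-symmetric : ∀ {n} (G₁ G₂ : Graph n) {M : Mat n} →
  (∀ i j → adj G₁ i j ≡ zeroDiag (adj G₂ ⊞ M) i j) → Symmetric M
rankPerturbation-symmetric G₁ G₂ {M} G₁≡ i j with i ≟ j
... | yes refl = refl
... | no i≢j   = begin
  M i j                     ≡⟨ M≡ i≢j ⟩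
  adj G₂ i j xor adj G₁ i j ≡⟨ cong₂ _xor_ (symmetric G₂ i j) (symmetric G₁ i j) ⟩
  adj G₂ j i xor adj G₁ j i ≡⟨ M≡ (i≢j ∘ sym) ⟨
  M j i                     ∎
  where
  open ≡-Reasoning
  M≡ : ∀ {i j} → i ≢ j → M i j ≡ adj G₂ i j xor adj G₁ i j
  M≡ {i} {j} i≢j = trans (sym (xor-cancelˡ (adj G₂ i j) (M i j)))
                         (cong (adj G₂ i j xor_) (sym (trans (G₁≡ i j) (zeroDiag-≢ (adj G₂ ⊞ M) i≢j))))

gadget⇒perturbation : ∀ {n t} {M : Mat n} (G₁ G₂ : Graph n) → Gadget n t M →
  (∀ i j → adj G₁ i j ≡ zeroDiag (adj G₂ ⊞ M) i j) → Perturbation t G₁ G₂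
gadget⇒perturbation {n} {t} {M} G₁ G₂ gd G₁≡ = H , (map (n ↑ʳ_) moves , G₁-minor) , ([] , G₂-minor)
  where
  open Gadget gd
  K : Fin n ⊎ Fin t → Fin n ⊎ Fin t → Bool
  K = attach (adj G₂) neighbours (adj inner)
  H : Graph (n + t)
  H = attachGraph G₂ neighbours inner
  H≡K : ∀ a b → adj H (join n t a) (join n t b) ≡ K a b
  H≡K a b = cong₂ K (splitAt-join n t a) (splitAt-join n t b)
  G₂-minor : ∀ x y → adj G₂ x y ≡ adj H (x ↑ˡ t) (y ↑ˡ t)
  G₂-minor x y = sym (H≡K (inj₁ x) (inj₁ y))
  G₁-minor : ∀ x y → adj G₁ x y ≡ localComps (adj H) (map (n ↑ʳ_) moves) (x ↑ˡ t) (y ↑ˡ t)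
  G₁-minor x y = begin
    adj G₁ x y
      ≡⟨ G₁≡ x y ⟩
    zeroDiag (adj G₂ ⊞ M) x y
      ≡⟨ realises (adj G₂) (loopless G₂) x y ⟨
    localComps′ _≟⊎_ K (map inj₂ moves) (inj₁ x) (inj₁ y)
      ≡⟨ localComps′-induced _≟⊎_ _≟_ (join-injective n t) H≡K
                             (map inj₂ moves) (inj₁ x) (inj₁ y) ⟨
    localComps′ _≟_ (adj H) (map (join n t) (map inj₂ moves)) (x ↑ˡ t) (y ↑ˡ t)
      ≡⟨ cong (λ ms → localComps (adj H) ms (x ↑ˡ t) (y ↑ˡ t)) (map-∘ moves) ⟨
    localComps (adj H) (map (n ↑ʳ_) moves) (x ↑ˡ t) (y ↑ˡ t)
      ∎
    where open ≡-Reasoning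

lemma7p1 : ∀ {n : ℕ} (t : ℕ) (G₁ G₂ : Graph n) →
    RankPerturbation t G₁ G₂ → Perturbation t G₁ G₂
lemma7p1 t G₁ G₂ (M , rank-M≤t , G₁≡) =
  gadget⇒perturbation G₁ G₂ (gadget t (rankPerturbation-symmetric G₁ G₂ G₁≡) rank-M≤t) G₁≡
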